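{- Let $X=[0,1)\cap\mathbb{Q}$ with its usual order $\prec$, and let $\mathbf{B}$ be the Boolean algebra of good subsets of $X$ (defined below). Let $e\colon X\cup\{1\}\to\omega$ be a finite-to-one function, and define $\mathrm{int}$ and $\mathrm{osc}$ as below. Then for every countable atomless Boolean subalgebra $\mathbf{C}$ of $\mathbf{B}$ and every integer $n>0$ there exist $a,b\in\mathbf{C}$ such that $a\cap b=\emptyset$, $0\notin a\cup b$, and $\mathrm{osc}(a,b)=n$.
   Context: Each integer $n\ge 0$ is identified with the set $\{0,\dots,n-1\}$, and $\omega$ denotes the set of non-negative integers. A set $a\subseteq X$ is called good if there exist $n<\omega$ and a strictly increasing function $\mathrm{seq}_a\colon 2n\to X\cup\{1\}$ such that for every $x\in X$: $x\in a$ if and only if there is $i<n$ with $\mathrm{seq}_a(2i)\preceq x\prec \mathrm{seq}_a(2i+1)$ (i.e. $a$ is a finite union of separated half-open intervals $[\mathrm{seq}_a(2i),\mathrm{seq}_a(2i+1))$; this $\mathrm{seq}_a$ is uniquely determined by $a$). The set $\mathbf{B}$ of all good subsets of $X$ is a Boolean subalgebra of the power set of $X$ (it is a countable atomless Boolean algebra). For $a\in\mathbf{B}$, put $\mathrm{int}(a)=\{e(u): u\in\mathrm{Im}(\mathrm{seq}_a)\}$, a finite subset of $\omega$. For $a_0,a_1\in\mathbf{B}$ and $i<\omega$, say $a_0$ and $a_1$ oscillate at $i$ if there is $k\in\{0,1\}$ such that: (1) $i\in\mathrm{int}(a_k)\setminus\mathrm{int}(a_{1-k})$, and (2) if the set $S=\{j<i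 : j\in \mathrm{int}(a_k)\,\triangle\,\mathrm{int}(a_{1-k})\}$ is non-empty and $j=\max S$, then $j\in\mathrm{int}(a_{1-k})\setminus\mathrm{int}(a_k)$. Here $\triangle$ is symmetric difference. Define $\mathrm{osc}(a_0,a_1)$ to be the number of $i<\omega$ at which $a_0$ and $a_1$ oscillate. -}

module Defs where

open import Data.Nat as ℕ using (ℕ; _+_)
open import Data.Rational as ℚ using (ℚ; 0ℚ; 1ℚ)
open import Data.List using (List; []; _∷_; length; map)
open import Data.List.Relation.Unary.All using (All)
open import Data.List.Relation.Unary.Linked using (Linked)
open import Data.List.Relation.Unary.Unique.Propositional using (Unique)
open import Data.List.Membership.Propositional using (_∈_; _∉_)
open import Data.Product using (Σ; ∃; _×_; _,_)
open import Data.Sum using (_⊎_)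
open import Data.Empty using (⊥)
open import Relation.Nullary using (¬_)
open import Relation.Binary.PropositionalEquality using (_≡_)
open import Function.Bundles using (_⇔_)

InX : ℚ → Set
InX x = (0ℚ ℚ.≤ x) × (x ℚ.< 1ℚ)

InX1 : ℚ → Set
InX1 x = (0ℚ ℚ.≤ x) × (x ℚ.≤ 1ℚ)

-- A good set a is represented by its (uniquely determined) sequence seq_a,
-- given as the list [seq_a(0), ..., seq_a(2n-1)].
-- IsSeq s : s is a strictly increasing list of even length in X ∪ {1}.
IsSeq : List ℚ → Set
IsSeq s = Linked ℚ._<_ s × All InX1 s × ∃ λ n → length s ≡ n + n

Mem : List ℚ → ℚ → Set
Mem (u ∷ v ∷ rest) x = ((u ℚ.≤ x) × (x ℚ.< v)) ⊎ Mem rest x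
Mem _ x = ⊥

record IsBooleanSubalgebra (C : List ℚ → Set) : Set where
  field
    good   : ∀ s → C s → IsSeq s
    zero∈  : Σ (List ℚ) λ c → C c × (∀ x → InX x → ¬ Mem c x)
    one∈   : Σ (List ℚ) λ c → C c × (∀ x → InX x → Mem c x)
    ∪-closed : ∀ a b → C a → C b →
      Σ (List ℚ) λ c → C c × (∀ x → InX x → Mem c x ⇔ (Mem a x ⊎ Mem b x))
    ∩-closed : ∀ a b → C a → C b →
      Σ (List ℚ) λ c → C c × (∀ x → InX x → Mem c x ⇔ (Mem a x × Mem b x))
    ∁-closed : ∀ a → C a →
      Σ (List ℚ) λ c → C c × (∀ x → InX x → Mem c x ⇔ (¬ Mem a x))

Countable : (List ℚ → Set) → Set
Countable C = Σ (ℕ → List ℚ) λ f → (∀ k → C (f k)) × (∀ s → C s → ∃ λ k → f k ≡ s)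

Atomless : (List ℚ → Set) → Set
Atomless C = ∀ a → C a → (∃ λ x → InX x × Mem a x) →
  Σ (List ℚ) λ b → C b
    × (∃ λ x → InX x × Mem b x)
    × (∀ x → InX x → Mem b x → Mem a x)
    × (∃ λ x → InX x × Mem a x × ¬ Mem b x)

-- e : X ∪ {1} → ω finite-to-one (values of e outside [0,1] are irrelevant)
FiniteToOne : (ℚ → ℕ) → Set
FiniteToOne e = ∀ k → Σ (List ℚ) λ L → ∀ q → InX1 q → e q ≡ k → q ∈ L

int : (ℚ → ℕ) → List ℚ → List ℕ
int e s = map e s

IsMaxOf : (ℕ → Set) → ℕ → Set
IsMaxOf S j = S j × (∀ j' → S j' → j' ℕ.≤ j)

OscAtWith : List ℕ → List ℕ → ℕ → Set
OscAtWith ik il i =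
  (i ∈ ik × i ∉ il) ×
  (∀ j → IsMaxOf (λ j → j ℕ.< i × ((j ∈ ik × j ∉ il) ⊎ (j ∈ il × j ∉ ik))) j →
     j ∈ il × j ∉ ik)

OscAt : (ℚ → ℕ) → List ℚ → List ℚ → ℕ → Set
OscAt e a0 a1 i = OscAtWith (int e a0) (int e a1) i ⊎ OscAtWith (int e a1) (int e a0) i

OscEq : (ℚ → ℕ) → List ℚ → List ℚ → ℕ → Set
OscEq e a0 a1 n = Σ (List ℕ) λ L → Unique L × (∀ i → i ∈ L ⇔ OscAt e a0 a1 i) × length L ≡ n

-- The pair (a, b) is built in n rounds from a = b = ∅, together with a nonempty reservoir R ∈ C that avoids 0
-- and is disjoint from a ∪ b. In each round R is split in two by atomlessness, and inside one half we find a
-- nonempty p ∈ C none of whose endpoints has e-value ≤ M, the largest e-value of an endpoint of a or b. This is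
-- possible because only finitely many points have e-value ≤ M and no point is an endpoint of three pairwise
-- disjoint good sets. Then (a, b) becomes (b, a ∪ p).
-- Since a and p are disjoint with disjoint endpoints, int(a ∪ p) = int a ∪ int p, with int p above M. This adds
-- exactly one oscillation, at min int p, provided the largest element of int a △ int b lies in int b; and this
-- invariant passes to the new pair.
-- The endpoint facts come from comparing membership at a point u with membership just below u: u is an endpoint
-- exactly when the two differ.
module Submission where

open import Defs
open import Level using (0ℓ)
open import Data.Nat using (ℕ; zero; suc)
open import Data.Rational using (ℚ; 0ℚ; 1ℚ)
open import Data.List using (List; []; _∷_; length; map; _++_)
open import Data.List.Relation.Unary.All as All using (All; []; _∷_)
open import Data.List.Relation.Unary.Any using (here; there)
open import Data.List.Membership.Propositional using (_∈_; _∉_)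
open import Data.Product using (Σ; ∃; _×_; _,_; proj₁; proj₂)
open import Data.Sum as Sum using (_⊎_; inj₁; inj₂)
open import Data.Empty using (⊥; ⊥-elim)
open import Function using (id; _∘_)
open import Function.Bundles using (_⇔_; mk⇔; Equivalence)
import Function.Properties.Equivalence as ⇔
open import Relation.Nullary using (¬_; Dec; yes; no; does)
open import Relation.Binary.PropositionalEquality using (_≡_; _≢_; refl; sym; trans; cong; cong₂; subst)
open import Relation.Unary using (Pred; Decidable; U; _∩_)

module GoodSets where

  open import Data.Bool using (Bool; true; false; T; T?; _∧_; _∨_; _xor_; not)
  open import Data.Bool.Properties using (T-∧; T-∨; ∨-identityʳ)
  open import Data.Nat using (_+_)
  import Data.Nat.Properties as ℕ
  open import Data.Rational as ℚ using (_≤_; _<_)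
  open import Data.Rational.Properties
    using ( _≤?_; _<?_; <-cmp; ≤-refl; ≤-trans; ≤-total; <⇒≤; ≮⇒≥; <-≤-trans; ≤-<-trans; <-trans; <-irrefl
          ; <-asym; <-dense; +-monoʳ-<; +-identityʳ; neg-antimono-< )
  open import Data.List.Relation.Unary.Linked as Linked using (Linked)
  open import Data.List.Relation.Unary.Linked.Properties using (Linked⇒AllPairs)
  import Data.List.Relation.Unary.AllPairs as AllPairs
  open import Data.Sum.Function.Propositional using (_⊎-⇔_)
  open import Relation.Nullary using (_×-dec_)
  import Relation.Nullary.Decidable as Dec
  open import Relation.Binary.Definitions using (tri<; tri≈; tri>)

  private
    <⇒≱ : ∀ {x y} → x < y → ¬ y ≤ x
    <⇒≱ x<y y≤x = <-irrefl refl (<-≤-trans x<y y≤x)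

  0<1 : 0ℚ < 1ℚ
  0<1 = Dec.toWitness {a? = 0ℚ <? 1ℚ} _

  data Good : List ℚ → Set where
    []   : Good []
    cons : ∀ {a b s} → 0ℚ ≤ a → a < b → b ≤ 1ℚ → All (b <_) s → Good s → Good (a ∷ b ∷ s)

  IsSeq⇒Good : ∀ {s} → IsSeq s → Good s
  IsSeq⇒Good {[]}        _                    = []
  IsSeq⇒Good {_ ∷ []}    (_ , _ , zero , ())
  IsSeq⇒Good {_ ∷ []}    (_ , _ , suc n , len) =
    ⊥-elim (ℕ.0≢1+n (trans (ℕ.suc-injective len) (ℕ.+-suc n n)))
  IsSeq⇒Good {_ ∷ _ ∷ _} (_ , _ , zero , ())
  IsSeq⇒Good {a ∷ b ∷ s} (linked , (0≤a , _) ∷ (_ , b≤1) ∷ s∈X₁ , suc n , len) =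
    cons 0≤a (Linked.head linked) b≤1 (AllPairs.head (Linked⇒AllPairs <-trans (Linked.tail linked)))
         (IsSeq⇒Good (Linked.tail (Linked.tail linked) , s∈X₁ , n , len′))
    where
    len′ : length s ≡ n + n
    len′ = ℕ.suc-injective (trans (ℕ.suc-injective len) (ℕ.+-suc n n))

  Mem⇒InX : ∀ {s x} → Good s → Mem s x → InX x
  Mem⇒InX (cons 0≤a _ b≤1 _ _) (inj₁ (a≤x , x<b)) = ≤-trans 0≤a a≤x , <-≤-trans x<b b≤1
  Mem⇒InX (cons _   _ _   _ g) (inj₂ x∈s)        = Mem⇒InX g x∈s

  Mem⇒endpoint : ∀ {s x} → Mem s x → ∃ λ u → u ∈ s
  Mem⇒endpoint {a ∷ _ ∷ _} _ = a , here refl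

  empty-Good⇒[] : ∀ {s} → Good s → (∀ x → InX x → ¬ Mem s x) → s ≡ []
  empty-Good⇒[] []                     _     = refl
  empty-Good⇒[] (cons 0≤a a<b b≤1 _ _) empty =
    ⊥-elim (empty _ (0≤a , <-≤-trans a<b b≤1) (inj₁ (≤-refl , a<b)))

  Disjoint : List ℚ → List ℚ → Set
  Disjoint s t = ∀ {x} → Mem s x → Mem t x → ⊥

  [_,_⟩? : ∀ a b x → Dec (a ≤ x × x < b)
  [ a , b ⟩? x = (a ≤? x) ×-dec (x <? b)

  ⟨_,_]? : ∀ a b x → Dec (a < x × x ≤ b)
  ⟨ a , b ]? x = (a <? x) ×-dec (x ≤? b)

  memᵇ : List ℚ → ℚ → Bool
  memᵇ (a ∷ b ∷ s) x = does ([ a , b ⟩? x) ∨ memᵇ s x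
  memᵇ _           x = false

  -- Membership with every [a, b) replaced by (a, b]: by leftᵇ-germ, it tells whether s contains the points
  -- just below x.
  leftᵇ : List ℚ → ℚ → Bool
  leftᵇ (a ∷ b ∷ s) x = does (⟨ a , b ]? x) ∨ leftᵇ s x
  leftᵇ _           x = false

  jumpᵇ : List ℚ → ℚ → Bool
  jumpᵇ s u = memᵇ s u xor leftᵇ s u

  T-does : ∀ {P : Set} (P? : Dec P) → T (does P?) ⇔ P
  T-does (yes p) = mk⇔ (λ _ → p) _
  T-does (no ¬p) = mk⇔ (λ ()) ¬p

  T-⇔⇒≡ : ∀ {a b} → T a ⇔ T b → a ≡ b
  T-⇔⇒≡ {true}  {true}  _   = refl
  T-⇔⇒≡ {false} {false} _   = refl
  T-⇔⇒≡ {true}  {false} a⇔b = ⊥-elim (Equivalence.to a⇔b _)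
  T-⇔⇒≡ {false} {true}  a⇔b = ⊥-elim (Equivalence.from a⇔b _)

  Mem⇔memᵇ : ∀ s x → Mem s x ⇔ T (memᵇ s x)
  Mem⇔memᵇ []          x = mk⇔ (λ ()) (λ ())
  Mem⇔memᵇ (_ ∷ [])    x = mk⇔ (λ ()) (λ ())
  Mem⇔memᵇ (a ∷ b ∷ s) x = ⇔.trans (⇔.sym (T-does ([ a , b ⟩? x)) ⊎-⇔ Mem⇔memᵇ s x) (⇔.sym T-∨)

  Mem? : ∀ s x → Dec (Mem s x)
  Mem? s x = Dec.map (⇔.sym (Mem⇔memᵇ s x)) (T? (memᵇ s x))

  memᵇ-∪ : ∀ {c s t} → (∀ x → Mem c x ⇔ (Mem s x ⊎ Mem t x)) → ∀ x → memᵇ c x ≡ memᵇ s x ∨ memᵇ t x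
  memᵇ-∪ {c} {s} {t} c≈s∪t x = T-⇔⇒≡ (⇔.trans (⇔.sym (Mem⇔memᵇ c x))
    (⇔.trans (c≈s∪t x) (⇔.trans (Mem⇔memᵇ s x ⊎-⇔ Mem⇔memᵇ t x) (⇔.sym T-∨))))

  memᵇ-∧-disjoint : ∀ {s t} → Disjoint s t → ∀ x → memᵇ s x ∧ memᵇ t x ≡ false
  memᵇ-∧-disjoint {s} {t} s⊥t x = T-⇔⇒≡ (mk⇔ (λ x∈s∩t → let (x∈s , x∈t) = Equivalence.to T-∧ x∈s∩t in
    s⊥t (Equivalence.from (Mem⇔memᵇ s x) x∈s) (Equivalence.from (Mem⇔memᵇ t x) x∈t)) λ ())

  memᵇ-head : ∀ a b s {x} → a ≤ x → x < b → memᵇ (a ∷ b ∷ s) x ≡ true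
  memᵇ-head a b s {x} a≤x x<b rewrite Dec.dec-true ([ a , b ⟩? x) (a≤x , x<b) = refl

  memᵇ-tail : ∀ a b s {x} → ¬ (a ≤ x × x < b) → memᵇ (a ∷ b ∷ s) x ≡ memᵇ s x
  memᵇ-tail a b s {x} x∉ rewrite Dec.dec-false ([ a , b ⟩? x) x∉ = refl

  leftᵇ-head : ∀ a b s {x} → a < x → x ≤ b → leftᵇ (a ∷ b ∷ s) x ≡ true
  leftᵇ-head a b s {x} a<x x≤b rewrite Dec.dec-true (⟨ a , b ]? x) (a<x , x≤b) = refl

  leftᵇ-tail : ∀ a b s {x} → ¬ (a < x × x ≤ b) → leftᵇ (a ∷ b ∷ s) x ≡ leftᵇ s x
  leftᵇ-tail a b s {x} x∉ rewrite Dec.dec-false (⟨ a , b ]? x) x∉ = refl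

  memᵇ-below : ∀ {u s} → All (u <_) s → memᵇ s u ≡ false
  memᵇ-below {s = []}        _               = refl
  memᵇ-below {s = _ ∷ []}    _               = refl
  memᵇ-below {s = a ∷ b ∷ s} (u<a ∷ _ ∷ u<s) =
    trans (memᵇ-tail a b s (λ (a≤u , _) → <⇒≱ u<a a≤u)) (memᵇ-below u<s)

  leftᵇ-below : ∀ {u s} → All (u <_) s → leftᵇ s u ≡ false
  leftᵇ-below {s = []}        _               = refl
  leftᵇ-below {s = _ ∷ []}    _               = refl
  leftᵇ-below {s = a ∷ b ∷ s} (u<a ∷ _ ∷ u<s) =
    trans (leftᵇ-tail a b s (λ (a<u , _) → <-asym u<a a<u)) (leftᵇ-below u<s)

  JustBelow : ℚ → Pred ℚ 0ℓ → Set
  JustBelow u P = ∃ λ l → l < u × ∀ {x} → l < x → x < u → P x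

  JustBelow-above : ∀ {l u} → l < u → JustBelow u (l <_)
  JustBelow-above {l} l<u = l , l<u , λ l<x _ → l<x

  JustBelow-somewhere : ∀ u → JustBelow u U
  JustBelow-somewhere u = u ℚ.- 1ℚ , u-1<u , _
    where
    u-1<u : u ℚ.- 1ℚ < u
    u-1<u = subst (u ℚ.- 1ℚ <_) (+-identityʳ u) (+-monoʳ-< u (neg-antimono-< 0<1))

  JustBelow-map : ∀ {u} {P Q : Pred ℚ 0ℓ} → (∀ {x} → x < u → P x → Q x) → JustBelow u P → JustBelow u Q
  JustBelow-map P⇒Q (l , l<u , P) = l , l<u , λ l<x x<u → P⇒Q x<u (P l<x x<u)

  JustBelow-∩ : ∀ {u} {P Q : Pred ℚ 0ℓ} → JustBelow u P → JustBelow u Q → JustBelow u (P ∩ Q)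
  JustBelow-∩ (l₁ , l₁<u , P) (l₂ , l₂<u , Q) with ≤-total l₁ l₂
  ... | inj₁ l₁≤l₂ = l₂ , l₂<u , λ l₂<x x<u → P (≤-<-trans l₁≤l₂ l₂<x) x<u , Q l₂<x x<u
  ... | inj₂ l₂≤l₁ = l₁ , l₁<u , λ l₁<x x<u → P l₁<x x<u , Q (≤-<-trans l₂≤l₁ l₁<x) x<u

  JustBelow-witness : ∀ {u} {P : Pred ℚ 0ℓ} → JustBelow u P → ∃ P
  JustBelow-witness (l , l<u , P) with <-dense l<u
  ... | x , l<x , x<u = x , P l<x x<u

  leftᵇ-germ : ∀ s u → JustBelow u (λ x → memᵇ s x ≡ leftᵇ s u)
  leftᵇ-germ []          u = JustBelow-map (λ _ _ → refl) (JustBelow-somewhere u)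
  leftᵇ-germ (_ ∷ [])    u = JustBelow-map (λ _ _ → refl) (JustBelow-somewhere u)
  leftᵇ-germ (a ∷ b ∷ s) u with ⟨ a , b ]? u | b <? u
  ... | yes (a<u , u≤b) | _ =
    a , a<u , λ a<x x<u →
      trans (memᵇ-head a b s (<⇒≤ a<x) (<-≤-trans x<u u≤b)) (sym (leftᵇ-head a b s a<u u≤b))
  ... | no u∉ | yes b<u =
    JustBelow-map (λ _ (b<x , x≡u) → trans (memᵇ-tail a b s (λ (_ , x<b) → <-asym b<x x<b))
                                           (trans x≡u (sym (leftᵇ-tail a b s u∉))))
                  (JustBelow-∩ (JustBelow-above b<u) (leftᵇ-germ s u))
  ... | no u∉ | no b≮u =
    JustBelow-map (λ x<u x≡u → trans (memᵇ-tail a b s (λ (a≤x , _) → u∉ (≤-<-trans a≤x x<u , ≮⇒≥ b≮u)))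
                                     (trans x≡u (sym (leftᵇ-tail a b s u∉))))
                  (leftᵇ-germ s u)

  leftᵇ-respects : ∀ (f : Bool → Bool → Bool) c s t → (∀ x → memᵇ c x ≡ f (memᵇ s x) (memᵇ t x)) →
                   ∀ u → leftᵇ c u ≡ f (leftᵇ s u) (leftᵇ t u)
  leftᵇ-respects f c s t c≡ u
    with JustBelow-witness (JustBelow-∩ (leftᵇ-germ c u) (JustBelow-∩ (leftᵇ-germ s u) (leftᵇ-germ t u)))
  ... | x , c≡ₓ , s≡ₓ , t≡ₓ = trans (sym c≡ₓ) (trans (c≡ x) (cong₂ f s≡ₓ t≡ₓ))

  -- The empty sequence [] plays the role of s ∩ t.
  leftᵇ-∧-disjoint : ∀ {s t} → Disjoint s t → ∀ u → leftᵇ s u ∧ leftᵇ t u ≡ false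
  leftᵇ-∧-disjoint {s} {t} s⊥t u = sym (leftᵇ-respects _∧_ [] s t (sym ∘ memᵇ-∧-disjoint s⊥t) u)

  ∈-∷∷ : ∀ {u a b : ℚ} {s} → u ∈ a ∷ b ∷ s ⇔ (u ≡ a ⊎ u ≡ b ⊎ u ∈ s)
  ∈-∷∷ = mk⇔ (λ { (here p) → inj₁ p ; (there (here p)) → inj₂ (inj₁ p) ; (there (there p)) → inj₂ (inj₂ p) })
             Sum.[ here , Sum.[ there ∘ here , there ∘ there ] ]

  interval-jump : ∀ {a b u} → a < b → (d : Dec (a ≤ u × u < b)) (d′ : Dec (a < u × u ≤ b)) →
                  T (does d xor does d′) ⇔ (u ≡ a ⊎ u ≡ b)
  interval-jump a<b (yes (_ , u<b)) (yes (a<u , _)) =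
    mk⇔ (λ ()) (λ { (inj₁ refl) → <-irrefl refl a<u ; (inj₂ refl) → <-irrefl refl u<b })
  interval-jump {a} {b} {u} a<b (yes (a≤u , u<b)) (no u∉) = mk⇔ (λ _ → inj₁ u≡a) _
    where
    u≡a : u ≡ a
    u≡a with <-cmp a u
    ... | tri< a<u _ _ = ⊥-elim (u∉ (a<u , <⇒≤ u<b))
    ... | tri≈ _ a≡u _ = sym a≡u
    ... | tri> _ _ u<a = ⊥-elim (<⇒≱ u<a a≤u)
  interval-jump {a} {b} {u} a<b (no u∉) (yes (a<u , u≤b)) = mk⇔ (λ _ → inj₂ u≡b) _
    where
    u≡b : u ≡ b
    u≡b with <-cmp u b
    ... | tri< u<b _ _ = ⊥-elim (u∉ (<⇒≤ a<u , u<b))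
    ... | tri≈ _ u≡b _ = u≡b
    ... | tri> _ _ b<u = ⊥-elim (<⇒≱ b<u u≤b)
  interval-jump a<b (no u∉[) (no u∉⟨) =
    mk⇔ (λ ()) (λ { (inj₁ refl) → u∉[ (≤-refl , a<b) ; (inj₂ refl) → u∉⟨ (a<b , ≤-refl) })

  jump⇔∈ : ∀ {s} → Good s → ∀ u → T (jumpᵇ s u) ⇔ u ∈ s
  jump⇔∈ []                               u = mk⇔ (λ ()) (λ ())
  jump⇔∈ (cons {a} {b} {s} _ a<b _ b<s g) u with b <? u
  ... | yes b<u = subst (λ j → T j ⇔ u ∈ a ∷ b ∷ s) (sym jump≡)
    (⇔.trans (jump⇔∈ g u) (⇔.sym (⇔.trans ∈-∷∷ (mk⇔ in-tail (inj₂ ∘ inj₂)))))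
    where
    jump≡ : jumpᵇ (a ∷ b ∷ s) u ≡ jumpᵇ s u
    jump≡ = cong₂ _xor_ (memᵇ-tail a b s (λ (_ , u<b) → <-asym b<u u<b))
                        (leftᵇ-tail a b s (λ (_ , u≤b) → <⇒≱ b<u u≤b))
    in-tail : u ≡ a ⊎ u ≡ b ⊎ u ∈ s → u ∈ s
    in-tail (inj₁ refl)        = ⊥-elim (<-asym a<b b<u)
    in-tail (inj₂ (inj₁ refl)) = ⊥-elim (<-irrefl refl b<u)
    in-tail (inj₂ (inj₂ u∈s))  = u∈s
  ... | no b≮u = subst (λ j → T j ⇔ u ∈ a ∷ b ∷ s) (sym jump≡)
    (⇔.trans (interval-jump a<b ([ a , b ⟩? u) (⟨ a , b ]? u))
             (⇔.sym (⇔.trans ∈-∷∷ (mk⇔ in-head (Sum.map₂ inj₁)))))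
    where
    u<s : All (u <_) s
    u<s = All.map (≤-<-trans (≮⇒≥ b≮u)) b<s
    jump≡ : jumpᵇ (a ∷ b ∷ s) u ≡ does ([ a , b ⟩? u) xor does (⟨ a , b ]? u)
    jump≡ = cong₂ _xor_ (trans (cong (does ([ a , b ⟩? u) ∨_) (memᵇ-below u<s)) (∨-identityʳ _))
                        (trans (cong (does (⟨ a , b ]? u) ∨_) (leftᵇ-below u<s)) (∨-identityʳ _))
    in-head : u ≡ a ⊎ u ≡ b ⊎ u ∈ s → u ≡ a ⊎ u ≡ b
    in-head (inj₁ u≡a)        = inj₁ u≡a
    in-head (inj₂ (inj₁ u≡b)) = inj₂ u≡b
    in-head (inj₂ (inj₂ u∈s)) = ⊥-elim (<-irrefl refl (All.lookup u<s u∈s))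

  ∨-xor-∨-disjoint : ∀ m₁ m₂ l₁ l₂ → m₁ ∧ m₂ ≡ false → l₁ ∧ l₂ ≡ false → (m₁ xor l₁) ∧ (m₂ xor l₂) ≡ false →
                     (m₁ ∨ m₂) xor (l₁ ∨ l₂) ≡ (m₁ xor l₁) ∨ (m₂ xor l₂)
  ∨-xor-∨-disjoint true  true  _     _     ()
  ∨-xor-∨-disjoint true  false true  true  _ () _
  ∨-xor-∨-disjoint true  false true  false _ _  _  = refl
  ∨-xor-∨-disjoint true  false false true  _ _  ()
  ∨-xor-∨-disjoint true  false false false _ _  _  = refl
  ∨-xor-∨-disjoint false true  true  true  _ () _
  ∨-xor-∨-disjoint false true  true  false _ _  ()
  ∨-xor-∨-disjoint false true  false true  _ _  _  = refl
  ∨-xor-∨-disjoint false true  false false _ _  _  = refl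
  ∨-xor-∨-disjoint false false _     _     _ _  _  = refl

  T-xor⇒≡not : ∀ m l → T (m xor l) → l ≡ not m
  T-xor⇒≡not true  false _ = refl
  T-xor⇒≡not false true  _ = refl

  two-of-three-agree : ∀ a b c → a ∧ b ≡ false → a ∧ c ≡ false → b ∧ c ≡ false →
                       not a ∧ not b ≡ false → not a ∧ not c ≡ false → not b ∧ not c ≡ false → ⊥
  two-of-three-agree true  true  _     () _  _  _  _  _
  two-of-three-agree true  false true  _  () _  _  _  _
  two-of-three-agree true  false false _  _  _  _  _  ()
  two-of-three-agree false true  true  _  _  () _  _  _
  two-of-three-agree false true  false _  _  _  _  () _
  two-of-three-agree false false _     _  _  _  () _  _

  endpoints-∪ : ∀ {s t c} → Good s → Good t → Good c → Disjoint s t →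
                (∀ x → Mem c x ⇔ (Mem s x ⊎ Mem t x)) → (∀ {u} → u ∈ s → u ∉ t) →
                ∀ {u} → u ∈ c ⇔ (u ∈ s ⊎ u ∈ t)
  endpoints-∪ {s} {t} {c} gs gt gc s⊥t c≈s∪t s∉t {u} =
    ⇔.trans (⇔.sym (jump⇔∈ gc u))
            (subst (λ j → T j ⇔ (u ∈ s ⊎ u ∈ t)) (sym jump≡) (⇔.trans T-∨ (jump⇔∈ gs u ⊎-⇔ jump⇔∈ gt u)))
    where
    no-common-jump : jumpᵇ s u ∧ jumpᵇ t u ≡ false
    no-common-jump = T-⇔⇒≡ (mk⇔ (λ jumps → let (js , jt) = Equivalence.to T-∧ jumps in
      s∉t (Equivalence.to (jump⇔∈ gs u) js) (Equivalence.to (jump⇔∈ gt u) jt)) λ ())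
    jump≡ : jumpᵇ c u ≡ jumpᵇ s u ∨ jumpᵇ t u
    jump≡ = trans (cong₂ _xor_ (memᵇ-∪ c≈s∪t u) (leftᵇ-respects _∨_ c s t (memᵇ-∪ c≈s∪t) u))
                  (∨-xor-∨-disjoint (memᵇ s u) (memᵇ t u) (leftᵇ s u) (leftᵇ t u)
                    (memᵇ-∧-disjoint s⊥t u) (leftᵇ-∧-disjoint s⊥t u) no-common-jump)

  no-common-endpoint : ∀ {s t w} → Good s → Good t → Good w →
                       Disjoint s t → Disjoint s w → Disjoint t w → ∀ {u} → u ∈ s → u ∈ t → u ∈ w → ⊥
  no-common-endpoint {s} {t} {w} gs gt gw s⊥t s⊥w t⊥w {u} u∈s u∈t u∈w =
    two-of-three-agree (memᵇ s u) (memᵇ t u) (memᵇ w u)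
      (memᵇ-∧-disjoint s⊥t u) (memᵇ-∧-disjoint s⊥w u) (memᵇ-∧-disjoint t⊥w u)
      (not-memᵇ-∧ gs gt u∈s u∈t s⊥t) (not-memᵇ-∧ gs gw u∈s u∈w s⊥w) (not-memᵇ-∧ gt gw u∈t u∈w t⊥w)
    where
    leftᵇ≡not-memᵇ : ∀ {r} → Good r → u ∈ r → leftᵇ r u ≡ not (memᵇ r u)
    leftᵇ≡not-memᵇ gr u∈r = T-xor⇒≡not _ _ (Equivalence.from (jump⇔∈ gr u) u∈r)
    not-memᵇ-∧ : ∀ {r r′} → Good r → Good r′ → u ∈ r → u ∈ r′ → Disjoint r r′ →
                 not (memᵇ r u) ∧ not (memᵇ r′ u) ≡ false
    not-memᵇ-∧ gr gr′ u∈r u∈r′ r⊥r′ =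
      trans (cong₂ _∧_ (sym (leftᵇ≡not-memᵇ gr u∈r)) (sym (leftᵇ≡not-memᵇ gr′ u∈r′))) (leftᵇ-∧-disjoint r⊥r′ u)

module Oscillation where

  open import Data.Nat using (_≤_; _<_; _≤?_)
  open import Data.Nat.Properties
    using (_≟_; ≤-refl; ≤-trans; <-≤-trans; ≤-<-trans; n<1+n; m≤n⇒m≤1+n; m≤n⇒m<n∨m≡n; ≤-pred; <⇒≤; ≰⇒>; <⇒≱)
  open import Data.List.Relation.Unary.AllPairs using ([]; _∷_)
  open import Data.List.Relation.Unary.Unique.Propositional using (Unique)
  open import Data.List.Membership.DecPropositional _≟_ using (_∈?_)
  open import Data.List.Extrema.Nat using (min; min≤⊤; min≤xs; argmin-sel)

  _△_ : List ℕ → List ℕ → Pred ℕ 0ℓ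
  (x △ y) j = (j ∈ x × j ∉ y) ⊎ (j ∈ y × j ∉ x)

  _△?_ : ∀ x y → Decidable (x △ y)
  (x △? y) j with j ∈? x | j ∈? y
  ... | yes j∈x | yes j∈y = no λ { (inj₁ (_ , j∉y)) → j∉y j∈y ; (inj₂ (_ , j∉x)) → j∉x j∈x }
  ... | yes j∈x | no  j∉y = yes (inj₁ (j∈x , j∉y))
  ... | no  j∉x | yes j∈y = yes (inj₂ (j∈y , j∉x))
  ... | no  j∉x | no  j∉y = no λ { (inj₁ (j∈x , _)) → j∉x j∈x ; (inj₂ (j∈y , _)) → j∉y j∈y }

  -- OscAtWith x y i unfolds to (i ∈ x × i ∉ y) × Trails (_< i) x y.
  Trails : Pred ℕ 0ℓ → List ℕ → List ℕ → Set
  Trails D x y = ∀ j → IsMaxOf (D ∩ (x △ y)) j → j ∈ y × j ∉ x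

  Osc : List ℕ → List ℕ → ℕ → Set
  Osc x y i = OscAtWith x y i ⊎ OscAtWith y x i

  IsMaxOf-cong : ∀ {P Q : Pred ℕ 0ℓ} {j} → (∀ k → P k ⇔ Q k) → IsMaxOf P j → IsMaxOf Q j
  IsMaxOf-cong P⇔Q (Pj , max) =
    Equivalence.to (P⇔Q _) Pj , λ k Qk → max k (Equivalence.from (P⇔Q k) Qk)

  greatest-below : ∀ {P : Pred ℕ 0ℓ} → Decidable P → ∀ {k} i → k < i → P k → ∃ (IsMaxOf ((_< i) ∩ P))
  greatest-below {P} P? (suc i) k<1+i Pk with P? i
  ... | yes Pi = i , (n<1+n i , Pi) , λ _ (j<1+i , _) → ≤-pred j<1+i
  ... | no ¬Pi with m≤n⇒m<n∨m≡n (≤-pred k<1+i)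
  ...   | inj₂ refl = ⊥-elim (¬Pi Pk)
  ...   | inj₁ k<i with greatest-below P? i k<i Pk
  ...     | j , (j<i , Pj) , max = j , (m≤n⇒m≤1+n j<i , Pj) , max′
    where
    max′ : ∀ j′ → j′ < suc i × P j′ → j′ ≤ j
    max′ j′ (j′<1+i , Pj′) with m≤n⇒m<n∨m≡n (≤-pred j′<1+i)
    ... | inj₁ j′<i  = max j′ (j′<i , Pj′)
    ... | inj₂ refl = ⊥-elim (¬Pi Pj′)

  △-cong : ∀ {D : Pred ℕ 0ℓ} {x x′ y y′} → (∀ {j} → D j → j ∈ x ⇔ j ∈ x′) → (∀ {j} → D j → j ∈ y ⇔ j ∈ y′) →
           ∀ j → (D ∩ (x △ y)) j ⇔ (D ∩ (x′ △ y′)) j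
  △-cong x≈x′ y≈y′ j = mk⇔
    (λ { (Dj , inj₁ (j∈x , j∉y)) → Dj , inj₁ (to (x≈x′ Dj) j∈x , j∉y ∘ from (y≈y′ Dj))
       ; (Dj , inj₂ (j∈y , j∉x)) → Dj , inj₂ (to (y≈y′ Dj) j∈y , j∉x ∘ from (x≈x′ Dj)) })
    (λ { (Dj , inj₁ (j∈x′ , j∉y′)) → Dj , inj₁ (from (x≈x′ Dj) j∈x′ , j∉y′ ∘ to (y≈y′ Dj))
       ; (Dj , inj₂ (j∈y′ , j∉x′)) → Dj , inj₂ (from (y≈y′ Dj) j∈y′ , j∉x′ ∘ to (x≈x′ Dj)) })
    where open Equivalence

  Trails-cong : ∀ {D : Pred ℕ 0ℓ} {x x′ y y′} →
                (∀ {j} → D j → j ∈ x ⇔ j ∈ x′) → (∀ {j} → D j → j ∈ y ⇔ j ∈ y′) → Trails D x y → Trails D x′ y′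
  Trails-cong x≈x′ y≈y′ trails j j-max with trails j (IsMaxOf-cong (⇔.sym ∘ △-cong x≈x′ y≈y′) j-max)
  ... | j∈y , j∉x = let Dj = proj₁ (proj₁ j-max) in
    Equivalence.to (y≈y′ Dj) j∈y , j∉x ∘ Equivalence.from (x≈x′ Dj)

  Trails-restrict : ∀ {D : Pred ℕ 0ℓ} {x y} → (∀ {j} → (x △ y) j → D j) → Trails U x y → Trails D x y
  Trails-restrict △⊆D trails j ((_ , j∈△) , max) = trails j ((_ , j∈△) , λ k (_ , k∈△) → max k (△⊆D k∈△ , k∈△))

  OscAtWith-cong : ∀ {x x′ y y′ i} → (∀ {j} → j ≤ i → j ∈ x ⇔ j ∈ x′) → (∀ {j} → j ≤ i → j ∈ y ⇔ j ∈ y′) →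
                   OscAtWith x y i → OscAtWith x′ y′ i
  OscAtWith-cong x≈x′ y≈y′ ((i∈x , i∉y) , trails) =
    (Equivalence.to (x≈x′ ≤-refl) i∈x , i∉y ∘ Equivalence.from (y≈y′ ≤-refl)) ,
    Trails-cong (x≈x′ ∘ <⇒≤) (y≈y′ ∘ <⇒≤) trails

  Osc-cong : ∀ {x x′ y y′ i} → (∀ {j} → j ≤ i → j ∈ x ⇔ j ∈ x′) → (∀ {j} → j ≤ i → j ∈ y ⇔ j ∈ y′) →
             Osc x y i ⇔ Osc x′ y′ i
  Osc-cong x≈x′ y≈y′ = mk⇔
    (Sum.map (OscAtWith-cong x≈x′ y≈y′) (OscAtWith-cong y≈y′ x≈x′))
    (Sum.map (OscAtWith-cong (⇔.sym ∘ x≈x′) (⇔.sym ∘ y≈y′)) (OscAtWith-cong (⇔.sym ∘ y≈y′) (⇔.sym ∘ x≈x′)))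

  Osc-sym : ∀ {x y i} → Osc x y i ⇔ Osc y x i
  Osc-sym = mk⇔ Sum.swap Sum.swap

  Osc⇒∈ : ∀ {x y i} → Osc x y i → i ∈ x ⊎ i ∈ y
  Osc⇒∈ (inj₁ ((i∈x , _) , _)) = inj₁ i∈x
  Osc⇒∈ (inj₂ ((i∈y , _) , _)) = inj₂ i∈y

  module OscillationStep {x y z p : List ℕ} {M m : ℕ}
    (x≤M : ∀ {i} → i ∈ x → i ≤ M) (y≤M : ∀ {i} → i ∈ y → i ≤ M)
    (M<p : ∀ {i} → i ∈ p → M < i) (m∈p : m ∈ p) (m≤p : ∀ {i} → i ∈ p → m ≤ i)
    (z≈x∪p : ∀ {i} → i ∈ z ⇔ (i ∈ x ⊎ i ∈ p))
    (x-trails-y : Trails U x y)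
    where

    M<m : M < m
    M<m = M<p m∈p

    z≈x-below-m : ∀ {i} → i < m → i ∈ z ⇔ i ∈ x
    z≈x-below-m i<m = mk⇔
      (λ i∈z → Sum.[ id , (λ i∈p → ⊥-elim (<⇒≱ i<m (m≤p i∈p))) ] (Equivalence.to z≈x∪p i∈z))
      (Equivalence.from z≈x∪p ∘ inj₁)

    m∈z∖y : m ∈ z × m ∉ y
    m∈z∖y = Equivalence.from z≈x∪p (inj₂ m∈p) , λ m∈y → <⇒≱ M<m (y≤M m∈y)

    Osc-x-y≤M : ∀ {i} → Osc x y i → i ≤ M
    Osc-x-y≤M = Sum.[ x≤M , y≤M ] ∘ Osc⇒∈

    Osc-low : ∀ {i} → i ≤ M → Osc z y i ⇔ Osc x y i
    Osc-low i≤M = Osc-cong (λ j≤i → z≈x-below-m (≤-<-trans (≤-trans j≤i i≤M) M<m)) (λ _ → ⇔.refl)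

    Osc-at-m : Osc z y m
    Osc-at-m = inj₁ (m∈z∖y ,
      Trails-cong (⇔.sym ∘ z≈x-below-m) (λ _ → ⇔.refl) (Trails-restrict △≤M x-trails-y))
      where
      △≤M : ∀ {j} → (x △ y) j → j < m
      △≤M (inj₁ (j∈x , _)) = ≤-<-trans (x≤M j∈x) M<m
      △≤M (inj₂ (j∈y , _)) = ≤-<-trans (y≤M j∈y) M<m

    Osc-high : ∀ {i} → M < i → Osc z y i → i ≡ m
    Osc-high M<i (inj₂ ((i∈y , _) , _)) = ⊥-elim (<⇒≱ M<i (y≤M i∈y))
    Osc-high {i} M<i (inj₁ ((i∈z , _) , z-trails-y)) with Equivalence.to z≈x∪p i∈z
    ... | inj₁ i∈x = ⊥-elim (<⇒≱ M<i (x≤M i∈x))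
    ... | inj₂ i∈p with m≤n⇒m<n∨m≡n (m≤p i∈p)
    ...   | inj₂ m≡i = sym m≡i
    ...   | inj₁ m<i with greatest-below (z △? y) i m<i (inj₁ m∈z∖y)
    ...     | j , j-max = ⊥-elim (<⇒≱ (<-≤-trans M<m (proj₂ j-max m (m<i , inj₁ m∈z∖y)))
                                     (y≤M (proj₁ (z-trails-y j j-max))))

    Osc-z-y : ∀ i → Osc z y i ⇔ (i ≡ m ⊎ Osc x y i)
    Osc-z-y i with i ≤? M
    ... | yes i≤M = ⇔.trans (Osc-low i≤M)
      (mk⇔ inj₂ Sum.[ (λ { refl → ⊥-elim (<⇒≱ M<m i≤M) }) , id ])
    ... | no  i≰M = mk⇔ (inj₁ ∘ Osc-high (≰⇒> i≰M))
      Sum.[ (λ { refl → Osc-at-m }) , (λ o → ⊥-elim (i≰M (Osc-x-y≤M o))) ]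

    y-trails-z : Trails U y z
    y-trails-z j ((_ , inj₂ j∈z∖y) , _) = j∈z∖y
    y-trails-z j ((_ , inj₁ (j∈y , _)) , max) =
      ⊥-elim (<⇒≱ (<-≤-trans M<m (max m (_ , inj₂ m∈z∖y))) (y≤M j∈y))

  HasSize : Pred ℕ 0ℓ → ℕ → Set
  HasSize P n = Σ (List ℕ) λ L → Unique L × (∀ i → i ∈ L ⇔ P i) × length L ≡ n

  HasSize-empty : ∀ {P : Pred ℕ 0ℓ} → (∀ {i} → ¬ P i) → HasSize P 0
  HasSize-empty ¬P = [] , [] , (λ _ → mk⇔ (λ ()) (⊥-elim ∘ ¬P)) , refl

  HasSize-insert : ∀ {P Q : Pred ℕ 0ℓ} {m n} →
                   (∀ i → Q i ⇔ (i ≡ m ⊎ P i)) → ¬ P m → HasSize P n → HasSize Q (suc n)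
  HasSize-insert {P} {Q} {m} Q≈m∪P ¬Pm (L , unique , L≈P , refl) =
    m ∷ L , All.tabulate m∉L ∷ unique , m∷L≈Q , refl
    where
    m∉L : ∀ {j} → j ∈ L → m ≢ j
    m∉L j∈L refl = ¬Pm (Equivalence.to (L≈P _) j∈L)
    m∷L≈Q : ∀ i → i ∈ m ∷ L ⇔ Q i
    m∷L≈Q i = ⇔.trans (mk⇔ (λ { (here i≡m) → inj₁ i≡m ; (there i∈L) → inj₂ (Equivalence.to (L≈P i) i∈L) })
                           Sum.[ here , there ∘ Equivalence.from (L≈P i) ])
                      (⇔.sym (Q≈m∪P i))

  least-element : ∀ {k} {xs : List ℕ} → k ∈ xs → ∃ λ m → m ∈ xs × ∀ {i} → i ∈ xs → m ≤ i
  least-element {xs = y ∷ ys} _ =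
    min y ys , min∈ , λ { (here refl) → min≤⊤ y ys ; (there i∈ys) → All.lookup (min≤xs y ys) i∈ys }
    where
    min∈ : min y ys ∈ y ∷ ys
    min∈ = Sum.[ here , there ]′ (argmin-sel id y ys)

module Construction (e : ℚ → ℕ) (finite-to-one : FiniteToOne e) (C : List ℚ → Set)
                    (C-subalgebra : IsBooleanSubalgebra C) (atomless : Atomless C) where

  open import Data.Nat using (_≤_; _<_)
  open import Data.Nat.Properties using (n≤0⇒n≡0; m≤n⇒m<n∨m≡n; ≤-pred; ≰⇒>; <⇒≱)
  open import Data.Rational.Properties as ℚ using ()
  open import Data.List.Membership.Propositional.Properties using (∈-map⁺; ∈-map⁻; ∈-++⁺ˡ; ∈-++⁺ʳ)
  open import Data.List.Membership.DecPropositional ℚ._≟_ using (_∈?_)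
  open import Data.List.Extrema.Nat using (max; xs≤max)
  open import Data.Product.Function.NonDependent.Propositional using (_×-⇔_)
  open IsBooleanSubalgebra C-subalgebra
  open GoodSets
  open Oscillation

  C⇒Good : ∀ {s} → C s → Good s
  C⇒Good s∈C = IsSeq⇒Good (good _ s∈C)

  Nonempty : List ℚ → Set
  Nonempty s = ∃ λ x → InX x × Mem s x

  Mem-extend : ∀ {c} {P : Pred ℚ 0ℓ} → C c → (∀ {x} → P x → InX x) →
               (∀ x → InX x → Mem c x ⇔ P x) → ∀ x → Mem c x ⇔ P x
  Mem-extend c∈C P⇒X c≈P x = mk⇔
    (λ x∈c → Equivalence.to (c≈P x (Mem⇒InX (C⇒Good c∈C) x∈c)) x∈c)
    (λ Px → Equivalence.from (c≈P x (P⇒X Px)) Px)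

  union : ∀ {s t} → C s → C t → Σ (List ℚ) λ c → C c × (∀ x → Mem c x ⇔ (Mem s x ⊎ Mem t x))
  union s∈C t∈C with ∪-closed _ _ s∈C t∈C
  ... | c , c∈C , c≈s∪t =
    c , c∈C , Mem-extend c∈C Sum.[ Mem⇒InX (C⇒Good s∈C) , Mem⇒InX (C⇒Good t∈C) ] c≈s∪t

  difference : ∀ {s t} → C s → C t → Σ (List ℚ) λ d → C d × (∀ x → Mem d x ⇔ (Mem s x × ¬ Mem t x))
  difference s∈C t∈C with ∁-closed _ t∈C
  ... | t̄ , t̄∈C , t̄≈∁t with ∩-closed _ _ s∈C t̄∈C
  ... | d , d∈C , d≈s∩t̄ = d , d∈C , Mem-extend d∈C (Mem⇒InX (C⇒Good s∈C) ∘ proj₁)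
    (λ x x∈X → ⇔.trans (d≈s∩t̄ x x∈X) (⇔.refl ×-⇔ t̄≈∁t x x∈X))

  []∈C : C []
  []∈C with zero∈
  ... | z , z∈C , z-empty = subst C (empty-Good⇒[] (C⇒Good z∈C) z-empty) z∈C

  record Part (r : List ℚ) : Set where
    field
      seq      : List ℚ
      seq∈C    : C seq
      nonempty : Nonempty seq
      seq⊆r    : ∀ {x} → Mem seq x → Mem r x
  open Part

  whole : ∀ {r} → C r → Nonempty r → Part r
  whole {r} r∈C r≢∅ = record { seq = r ; seq∈C = r∈C ; nonempty = r≢∅ ; seq⊆r = λ x∈r → x∈r }

  Part-trans : ∀ {r} (p : Part r) → Part (seq p) → Part r
  Part-trans p q = record { seq = seq q ; seq∈C = seq∈C q ; nonempty = nonempty q ; seq⊆r = seq⊆r p ∘ seq⊆r q }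

  split : ∀ {r} → C r → Nonempty r → Σ (Part r × Part r) λ (p , q) → Disjoint (seq p) (seq q)
  split {r} r∈C r≢∅ with atomless r r∈C r≢∅
  ... | b , b∈C , b≢∅ , b⊆r , (x , x∈X , x∈r , x∉b) with difference r∈C b∈C
  ... | d , d∈C , d≈r∖b =
    ( record { seq = b ; seq∈C = b∈C ; nonempty = b≢∅
             ; seq⊆r = λ y∈b → b⊆r _ (Mem⇒InX (C⇒Good b∈C) y∈b) y∈b }
    , record { seq = d ; seq∈C = d∈C ; nonempty = x , x∈X , Equivalence.from (d≈r∖b x) (x∈r , x∉b)
             ; seq⊆r = proj₁ ∘ Equivalence.to (d≈r∖b _) } )
    , λ y∈b y∈d → proj₂ (Equivalence.to (d≈r∖b _) y∈d) y∈b

  split₃ : ∀ {r} → C r → Nonempty r → Σ (Part r × Part r × Part r) λ (p₁ , p₂ , p₃) →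
           Disjoint (seq p₁) (seq p₂) × Disjoint (seq p₁) (seq p₃) × Disjoint (seq p₂) (seq p₃)
  split₃ r∈C r≢∅ with split r∈C r≢∅
  ... | (p , q) , p⊥q with split (seq∈C q) (nonempty q)
  ... | (q₁ , q₂) , q₁⊥q₂ =
    (p , Part-trans q q₁ , Part-trans q q₂) ,
    (λ x∈p x∈q₁ → p⊥q x∈p (seq⊆r q₁ x∈q₁)) , (λ x∈p x∈q₂ → p⊥q x∈p (seq⊆r q₂ x∈q₂)) , q₁⊥q₂

  ∉-∷ : ∀ {f : ℚ} {F s} → f ∉ s → (∀ {u} → u ∈ s → u ∉ F) → ∀ {u} → u ∈ s → u ∉ f ∷ F
  ∉-∷ f∉s s∉F u∈s (here refl)  = f∉s u∈s
  ∉-∷ f∉s s∉F u∈s (there u∈F) = s∉F u∈s u∈F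

  -- Of three pairwise disjoint parts, at most two can have f as an endpoint.
  avoid : ∀ F {r} → C r → Nonempty r → Σ (Part r) λ p → ∀ {u} → u ∈ seq p → u ∉ F
  avoid []      r∈C r≢∅ = whole r∈C r≢∅ , λ _ ()
  avoid (f ∷ F) r∈C r≢∅ with split₃ r∈C r≢∅
  ... | (p₁ , p₂ , p₃) , p₁⊥p₂ , p₁⊥p₃ , p₂⊥p₃
    with avoid F (seq∈C p₁) (nonempty p₁) | avoid F (seq∈C p₂) (nonempty p₂) | avoid F (seq∈C p₃) (nonempty p₃)
  ... | q₁ , q₁∉F | q₂ , q₂∉F | q₃ , q₃∉F with f ∈? seq q₁ | f ∈? seq q₂ | f ∈? seq q₃
  ... | no f∉q₁ | _       | _       = Part-trans p₁ q₁ , ∉-∷ f∉q₁ q₁∉F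
  ... | yes _   | no f∉q₂ | _       = Part-trans p₂ q₂ , ∉-∷ f∉q₂ q₂∉F
  ... | yes _   | yes _   | no f∉q₃ = Part-trans p₃ q₃ , ∉-∷ f∉q₃ q₃∉F
  ... | yes f∈q₁ | yes f∈q₂ | yes f∈q₃ = ⊥-elim
    (no-common-endpoint (C⇒Good (seq∈C q₁)) (C⇒Good (seq∈C q₂)) (C⇒Good (seq∈C q₃))
      (λ x∈q₁ x∈q₂ → p₁⊥p₂ (seq⊆r q₁ x∈q₁) (seq⊆r q₂ x∈q₂))
      (λ x∈q₁ x∈q₃ → p₁⊥p₃ (seq⊆r q₁ x∈q₁) (seq⊆r q₃ x∈q₃))
      (λ x∈q₂ x∈q₃ → p₂⊥p₃ (seq⊆r q₂ x∈q₂) (seq⊆r q₃ x∈q₃))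
      f∈q₁ f∈q₂ f∈q₃)

  level≤ : ∀ M → Σ (List ℚ) λ F → ∀ {q} → InX1 q → e q ≤ M → q ∈ F
  level≤ zero with finite-to-one zero
  ... | F , F-complete = F , λ q∈X₁ eq≤0 → F-complete _ q∈X₁ (n≤0⇒n≡0 eq≤0)
  level≤ (suc M) with finite-to-one (suc M) | level≤ M
  ... | F , F-complete | F≤ , F≤-complete = F ++ F≤ , λ q∈X₁ eq≤1+M →
    Sum.[ (λ eq<1+M → ∈-++⁺ʳ F (F≤-complete q∈X₁ (≤-pred eq<1+M)))
        , (λ eq≡1+M → ∈-++⁺ˡ (F-complete _ q∈X₁ eq≡1+M)) ]′ (m≤n⇒m<n∨m≡n eq≤1+M)

  ∈-map-∪ : ∀ {c s t : List ℚ} → (∀ {u} → u ∈ c ⇔ (u ∈ s ⊎ u ∈ t)) →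
            ∀ {i} → i ∈ map e c ⇔ (i ∈ map e s ⊎ i ∈ map e t)
  ∈-map-∪ {c} {s} {t} c≈s∪t {i} = mk⇔ to from
    where
    to : i ∈ map e c → i ∈ map e s ⊎ i ∈ map e t
    to i∈ec with ∈-map⁻ e i∈ec
    ... | u , u∈c , refl = Sum.map (∈-map⁺ e) (∈-map⁺ e) (Equivalence.to c≈s∪t u∈c)
    from : i ∈ map e s ⊎ i ∈ map e t → i ∈ map e c
    from (inj₁ i∈es) with ∈-map⁻ e i∈es
    ... | u , u∈s , refl = ∈-map⁺ e (Equivalence.from c≈s∪t (inj₁ u∈s))
    from (inj₂ i∈et) with ∈-map⁻ e i∈et
    ... | u , u∈t , refl = ∈-map⁺ e (Equivalence.from c≈s∪t (inj₂ u∈t))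

  C⇒endpoints∈X₁ : ∀ {s} → C s → All InX1 s
  C⇒endpoints∈X₁ s∈C = proj₁ (proj₂ (good _ s∈C))

  level : List ℚ → List ℚ → ℕ
  level A B = max 0 (int e A ++ int e B)

  ≤level-left : ∀ {A B i} → i ∈ int e A → i ≤ level A B
  ≤level-left i∈A = All.lookup (xs≤max 0 _) (∈-++⁺ˡ i∈A)

  ≤level-right : ∀ {A B i} → i ∈ int e B → i ≤ level A B
  ≤level-right {A} i∈B = All.lookup (xs≤max 0 _) (∈-++⁺ʳ (int e A) i∈B)

  0∈X : InX 0ℚ
  0∈X = ℚ.≤-refl , 0<1

  region-without-0 : Σ (List ℚ) λ R → C R × Nonempty R × ¬ Mem R 0ℚ
  region-without-0 with one∈
  ... | X , X∈C , X-full with split X∈C (0ℚ , 0∈X , X-full 0ℚ 0∈X)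
  ... | (p , q) , p⊥q with Mem? (seq p) 0ℚ
  ... | no  0∉p = seq p , seq∈C p , nonempty p , 0∉p
  ... | yes 0∈p = seq q , seq∈C q , nonempty q , p⊥q 0∈p

  record Stage (k : ℕ) : Set where
    field
      A B R      : List ℚ
      A∈C        : C A
      B∈C        : C B
      R∈C        : C R
      R-nonempty : Nonempty R
      A⊥B        : Disjoint A B
      A⊥R        : Disjoint A R
      B⊥R        : Disjoint B R
      0∉A        : ¬ Mem A 0ℚ
      0∉B        : ¬ Mem B 0ℚ
      0∉R        : ¬ Mem R 0ℚ
      osc        : OscEq e A B k
      A-trails-B : Trails U (int e A) (int e B)

  initial : Stage 0
  initial with region-without-0
  ... | R , R∈C , R-nonempty , 0∉R = record
    { A = [] ; B = [] ; R = R
    ; A∈C = []∈C ; B∈C = []∈C ; R∈C = R∈C ; R-nonempty = R-nonempty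
    ; A⊥B = λ () ; A⊥R = λ () ; B⊥R = λ ()
    ; 0∉A = λ () ; 0∉B = λ () ; 0∉R = 0∉R
    ; osc = HasSize-empty λ { (inj₁ ((() , _) , _)) ; (inj₂ ((() , _) , _)) }
    ; A-trails-B = λ { _ ((_ , inj₁ (() , _)) , _) ; _ ((_ , inj₂ (() , _)) , _) } }

  above-level : ∀ {M s} → C s → (∀ {u} → u ∈ s → u ∉ proj₁ (level≤ M)) → ∀ {i} → i ∈ int e s → M < i
  above-level {M} s∈C s∉F i∈es with ∈-map⁻ e i∈es
  ... | v , v∈s , refl =
    ≰⇒> λ ev≤M → s∉F v∈s (proj₂ (level≤ M) (All.lookup (C⇒endpoints∈X₁ s∈C) v∈s) ev≤M)

  oscillation-step : ∀ {A B p c k} → C A → C p → C c → Disjoint A p → (∀ x → Mem c x ⇔ (Mem A x ⊎ Mem p x)) →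
                     Nonempty p → (∀ {i} → i ∈ int e p → level A B < i) →
                     OscEq e A B k → Trails U (int e A) (int e B) →
                     OscEq e B c (suc k) × Trails U (int e B) (int e c)
  oscillation-step {A} {B} {p} {c} A∈C p∈C c∈C A⊥p c≈A∪p (_ , _ , x∈p) M<int-p osc A-trails-B =
    HasSize-insert (λ i → ⇔.trans Osc-sym (Osc-z-y i)) (<⇒≱ M<m ∘ Osc-x-y≤M) osc , y-trails-z
    where
    endpoints-c : ∀ {u} → u ∈ c ⇔ (u ∈ A ⊎ u ∈ p)
    endpoints-c = endpoints-∪ (C⇒Good A∈C) (C⇒Good p∈C) (C⇒Good c∈C) A⊥p c≈A∪p
      (λ u∈A u∈p → <⇒≱ (M<int-p (∈-map⁺ e u∈p)) (≤level-left (∈-map⁺ e u∈A)))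
    least : ∃ λ m → m ∈ int e p × ∀ {i} → i ∈ int e p → m ≤ i
    least = least-element (∈-map⁺ e (proj₂ (Mem⇒endpoint x∈p)))
    open OscillationStep (≤level-left {A}) (≤level-right {A}) M<int-p (proj₁ (proj₂ least))
                         (proj₂ (proj₂ least)) (∈-map-∪ endpoints-c) A-trails-B

  step : ∀ {k} → Stage k → Stage (suc k)
  step {k} st with split (Stage.R∈C st) (Stage.R-nonempty st)
  ... | (R₁ , R₂) , R₁⊥R₂
    with avoid (proj₁ (level≤ (level (Stage.A st) (Stage.B st)))) (seq∈C R₁) (nonempty R₁)
  ... | p , p∉F with union (Stage.A∈C st) (seq∈C p)
  ... | c , c∈C , c≈A∪p = record
    { A = B ; B = c ; R = seq R₂
    ; A∈C = B∈C ; B∈C = c∈C ; R∈C = seq∈C R₂ ; R-nonempty = nonempty R₂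
    ; A⊥B = λ x∈B x∈c → Sum.[ (λ x∈A → A⊥B x∈A x∈B) , (λ x∈p → B⊥R x∈B (p⊆R x∈p)) ]′ (c→A∪p x∈c)
    ; A⊥R = λ x∈B x∈R₂ → B⊥R x∈B (seq⊆r R₂ x∈R₂)
    ; B⊥R = λ x∈c x∈R₂ →
        Sum.[ (λ x∈A → A⊥R x∈A (seq⊆r R₂ x∈R₂)) , (λ x∈p → R₁⊥R₂ (seq⊆r p x∈p) x∈R₂) ]′ (c→A∪p x∈c)
    ; 0∉A = 0∉B
    ; 0∉B = Sum.[ 0∉A , 0∉R ∘ p⊆R ]′ ∘ c→A∪p
    ; 0∉R = 0∉R ∘ seq⊆r R₂
    ; osc = proj₁ next
    ; A-trails-B = proj₂ next }
    where
    open Stage st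
    c→A∪p : ∀ {x} → Mem c x → Mem A x ⊎ Mem (seq p) x
    c→A∪p = Equivalence.to (c≈A∪p _)
    p⊆R : ∀ {x} → Mem (seq p) x → Mem R x
    p⊆R = seq⊆r R₁ ∘ seq⊆r p
    next : OscEq e B c (suc k) × Trails U (int e B) (int e c)
    next = oscillation-step A∈C (seq∈C p) c∈C (λ x∈A x∈p → A⊥R x∈A (p⊆R x∈p)) c≈A∪p (nonempty p)
                            (above-level (seq∈C p) p∉F) osc A-trails-B

  stage : ∀ k → Stage k
  stage zero    = initial
  stage (suc k) = step (stage k)

open import Data.Nat using (_<_)

theorem3p2 : (e : ℚ → ℕ) → FiniteToOne e →
    (C : List ℚ → Set) → IsBooleanSubalgebra C → Countable C → Atomless C →
    (n : ℕ) → 0 < n →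
    Σ (List ℚ) λ a → Σ (List ℚ) λ b → C a × C b
    × (∀ x → InX x → ¬ (Mem a x × Mem b x))
    × ¬ Mem a 0ℚ × ¬ Mem b 0ℚ
    × OscEq e a b n
theorem3p2 e finite-to-one C C-subalgebra _ atomless n _ =
  A , B , A∈C , B∈C , (λ _ _ (x∈A , x∈B) → A⊥B x∈A x∈B) , 0∉A , 0∉B , osc
  where
  open Construction e finite-to-one C C-subalgebra atomless
  open Stage (stage n)
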